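{- Let $\langle\ket{\psi},C,\mathcal{P}\rangle$ be a quantum system with $\mathcal{P}=\langle P_E,I-P_E\rangle$ and probability $\epsilon<1/4$ of outcome $E$. Let $S_{\ket{\psi}}=I-2\ket{\psi}\bra{\psi}$, $S_{\mathcal{P}}=I-2P_E$ (phases $\theta=\alpha=\pi$), and $\mathcal{Q}=C S_{\ket{\psi}} C^\dagger S_{\mathcal{P}}$. Define $\epsilon_0=\epsilon$, $\epsilon_{j+1}=\epsilon_j\Delta^*_{\epsilon_j}$, and let $k$ be the smallest integer with $\epsilon_k\ge 1/4$. Define $C_0=C$ and, for $0\le j<k$, $C_{j+1} = C_j S_{\ket{\psi}} C_j^\dagger S_{\mathcal{P}} C_j$ (the optimal Grover iterator $G^*_{\epsilon_j}(C_j,\ket{\psi},\mathcal{P})$, whose optimal phases are $\theta=\alpha=\pi$ since $\epsilon_j<1/4$). Then for every $j\in[1,k]$, $C_j = \mathcal{Q}^{(3^j-1)/2}\,C$.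
   Context: A quantum system $\langle\ket{\psi},C,\mathcal{P}\rangle$ consists of an input state $\ket{\psi}$, a unitary circuit $C$, and a two-outcome projective measurement $\mathcal{P}=\langle P_E, I-P_E\rangle$ (outcomes $E$, $F$). For $p\in[0,1]$, $\Delta^*_p$ denotes the maximum over $\theta,\alpha\in[0,\pi]$ of $|e^{\imath\theta}+e^{\imath\alpha}-1+(1-e^{\imath\alpha})(1-e^{\imath\theta})p|^2$; this is the factor by which the probability of outcome $E$ is multiplied by one application of the optimal Grover iterator, so $\epsilon_j$ is the probability of outcome $E$ for $\langle\ket{\psi},C_j,\mathcal{P}\rangle$. For $p\le1/4$ the maximum is attained at $\theta=\alpha=\pi$ and equals $(3-4p)^2$. -}

module Defs where

open import Level using (Level; _⊔_) renaming (suc to lsuc)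
open import Algebra.Bundles using (Ring)
open import Data.Nat using (ℕ; zero; suc)
open import Data.Product using (_×_)

-- The operators on a finite-dimensional
-- complex Hilbert space (complex n×n matrices with conjugate transpose)
-- form such a structure; ring elements play the role of operators and the
-- involution is the adjoint  _† .
record StarRing (c ℓ : Level) : Set (lsuc (c ⊔ ℓ)) where
  field
    ring : Ring c ℓ
  open Ring ring public
  field
    _†            : Carrier → Carrier
    †-cong        : ∀ {x y} → x ≈ y → x † ≈ y †
    †-involutive  : ∀ x → (x †) † ≈ x
    †-distrib-+   : ∀ x y → (x + y) † ≈ (x †) + (y †)
    †-antidistrib : ∀ x y → (x * y) † ≈ (y †) * (x †)
  infix 10 _†

module StarOps {c ℓ : Level} (R : StarRing c ℓ) where
  open StarRing R

  two : Carrier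
  two = 1# + 1#

  IsUnitary : Carrier → Set ℓ
  IsUnitary U = (U * (U †) ≈ 1#) × ((U †) * U ≈ 1#)

  IsProjector : Carrier → Set ℓ
  IsProjector P = (P † ≈ P) × (P * P ≈ P)

  -- reflection  I - 2P  (phase π);  S_ψ = reflect (|ψ⟩⟨ψ|),  S_P = reflect P_E
  reflect : Carrier → Carrier
  reflect P = 1# - two * P

  pow : Carrier → ℕ → Carrier
  pow Q zero    = 1#
  pow Q (suc n) = Q * pow Q n

  QOp : (C Pψ PE : Carrier) → Carrier
  QOp C Pψ PE = C * reflect Pψ * (C †) * reflect PE

  grover : (Pψ PE D : Carrier) → Carrier
  grover Pψ PE D = D * reflect Pψ * (D †) * reflect PE * D

  circ : (C Pψ PE : Carrier) → ℕ → Carrier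
  circ C Pψ PE zero    = C
  circ C Pψ PE (suc j) = grover Pψ PE (circ C Pψ PE j)

-- With R = C S_ψ C† and S = S_P both self-adjoint, 𝒬 = R S has adjoint S R, and
-- R (S R)^m S = (R S)^(m+1).  Hence if C_j = 𝒬^m C then
--   C_{j+1} = 𝒬^m C S_ψ C† (𝒬^m)† S_P 𝒬^m C = 𝒬^m R (S R)^m S 𝒬^m C = 𝒬^(3m+1) C,
-- and m ↦ 3m+1 started at 0 reaches (3^j − 1)/2 after j steps.
module Submission where

open import Defs
open import Level using (Level)
open import Data.Nat as ℕ using (ℕ; zero; suc; _≤_; _^_; _∸_; _/_)
open import Data.Nat.DivMod using (m*n/n≡m)
open import Data.Nat.Properties using (*-comm)
open import Data.Nat.Solver using (module +-*-Solver)
open import Data.Product using (_,_)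
open import Relation.Binary.PropositionalEquality as ≡ using (_≡_)
import Algebra.Properties.Group as GroupProperties
import Algebra.Solver.Monoid as MonoidSolver
import Relation.Binary.Reasoning.Setoid as SetoidReasoning

tripleSucc : ℕ → ℕ
tripleSucc m = m ℕ.+ suc m ℕ.+ m

groverExponent : ℕ → ℕ
groverExponent zero    = 0
groverExponent (suc j) = tripleSucc (groverExponent j)

3^≡1+2*groverExponent : ∀ j → 3 ^ j ≡ 1 ℕ.+ 2 ℕ.* groverExponent j
3^≡1+2*groverExponent zero    = ≡.refl
3^≡1+2*groverExponent (suc j) =
  ≡.trans (≡.cong (3 ℕ.*_) (3^≡1+2*groverExponent j)) (step (groverExponent j))
  where
  open +-*-Solver
  step : ∀ m → 3 ℕ.* (1 ℕ.+ 2 ℕ.* m) ≡ 1 ℕ.+ 2 ℕ.* tripleSucc m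
  step = solve 1 (λ m → con 3 :* (con 1 :+ con 2 :* m)
                      := con 1 :+ con 2 :* (m :+ (con 1 :+ m) :+ m)) ≡.refl

groverExponent≡[3^j∸1]/2 : ∀ j → groverExponent j ≡ (3 ^ j ∸ 1) / 2
groverExponent≡[3^j∸1]/2 j = begin
  groverExponent j                        ≡⟨ ≡.sym (m*n/n≡m (groverExponent j) 2) ⟩
  groverExponent j ℕ.* 2 / 2              ≡⟨ ≡.cong (_/ 2) (*-comm (groverExponent j) 2) ⟩
  (1 ℕ.+ 2 ℕ.* groverExponent j ∸ 1) / 2  ≡⟨ ≡.cong (λ n → (n ∸ 1) / 2) (≡.sym (3^≡1+2*groverExponent j)) ⟩
  (3 ^ j ∸ 1) / 2                         ∎
  where open ≡.≡-Reasoning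

module StarRingProperties {c ℓ : Level} (R : StarRing c ℓ) where
  open StarRing R
  open StarOps R
  open SetoidReasoning setoid
  open MonoidSolver *-monoid using (solve; _⊜_; _⊕_)
  open GroupProperties +-group using (identityˡ-unique; inverseˡ-unique)

  SelfAdjoint : Carrier → Set ℓ
  SelfAdjoint x = x † ≈ x

  1#-selfAdjoint : SelfAdjoint 1#
  1#-selfAdjoint = begin
    1# †            ≈⟨ *-identityˡ (1# †) ⟨
    1# * 1# †       ≈⟨ *-congʳ (†-involutive 1#) ⟨
    1# † † * 1# †   ≈⟨ †-antidistrib 1# (1# †) ⟨
    (1# * 1# †) †   ≈⟨ †-cong (*-identityˡ (1# †)) ⟩
    1# † †          ≈⟨ †-involutive 1# ⟩
    1#              ∎

  0#-selfAdjoint : SelfAdjoint 0#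
  0#-selfAdjoint = identityˡ-unique (0# †) (0# †) (begin
    0# † + 0# †  ≈⟨ †-distrib-+ 0# 0# ⟨
    (0# + 0#) †  ≈⟨ †-cong (+-identityˡ 0#) ⟩
    0# †         ∎)

  †-neg : ∀ x → (- x) † ≈ - (x †)
  †-neg x = inverseˡ-unique ((- x) †) (x †) (begin
    (- x) † + x †  ≈⟨ †-distrib-+ (- x) x ⟨
    (- x + x) †    ≈⟨ †-cong (-‿inverseˡ x) ⟩
    0# †           ≈⟨ 0#-selfAdjoint ⟩
    0#             ∎)

  two-selfAdjoint : SelfAdjoint two
  two-selfAdjoint = trans (†-distrib-+ 1# 1#) (+-cong 1#-selfAdjoint 1#-selfAdjoint)

  two-comm : ∀ x → x * two ≈ two * x
  two-comm x = begin
    x * two          ≈⟨ distribˡ x 1# 1# ⟩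
    x * 1# + x * 1#  ≈⟨ +-cong (*-identityʳ x) (*-identityʳ x) ⟩
    x + x            ≈⟨ +-cong (*-identityˡ x) (*-identityˡ x) ⟨
    1# * x + 1# * x  ≈⟨ distribʳ x 1# 1# ⟨
    two * x          ∎

  reflect-selfAdjoint : ∀ {P} → SelfAdjoint P → SelfAdjoint (reflect P)
  reflect-selfAdjoint {P} P† = begin
    (1# - two * P) †        ≈⟨ †-distrib-+ 1# (- (two * P)) ⟩
    1# † + (- (two * P)) †  ≈⟨ +-cong 1#-selfAdjoint (†-neg (two * P)) ⟩
    1# - (two * P) †        ≈⟨ +-congˡ (-‿cong (†-antidistrib two P)) ⟩
    1# - P † * two †        ≈⟨ +-congˡ (-‿cong (*-cong P† two-selfAdjoint)) ⟩
    1# - P * two            ≈⟨ +-congˡ (-‿cong (two-comm P)) ⟩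
    1# - two * P            ∎

  conjugate-selfAdjoint : ∀ u {x} → SelfAdjoint x → SelfAdjoint (u * x * u †)
  conjugate-selfAdjoint u {x} x† = begin
    (u * x * u †) †      ≈⟨ †-antidistrib (u * x) (u †) ⟩
    u † † * (u * x) †    ≈⟨ *-cong (†-involutive u) (†-antidistrib u x) ⟩
    u * (x † * u †)      ≈⟨ *-congˡ (*-congʳ x†) ⟩
    u * (x * u †)        ≈⟨ *-assoc u x (u †) ⟨
    u * x * u †          ∎

  †-*-selfAdjoint : ∀ {x y} → SelfAdjoint x → SelfAdjoint y → (x * y) † ≈ y * x
  †-*-selfAdjoint {x} {y} x† y† = trans (†-antidistrib x y) (*-cong y† x†)

  pow-cong : ∀ {x y} m → x ≈ y → pow x m ≈ pow y m
  pow-cong zero    x≈y = refl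
  pow-cong (suc m) x≈y = *-cong x≈y (pow-cong m x≈y)

  pow-+ : ∀ x m n → pow x (m ℕ.+ n) ≈ pow x m * pow x n
  pow-+ x zero    n = sym (*-identityˡ (pow x n))
  pow-+ x (suc m) n = trans (*-congˡ (pow-+ x m n)) (sym (*-assoc x (pow x m) (pow x n)))

  pow-sucʳ : ∀ x m → pow x m * x ≈ pow x (suc m)
  pow-sucʳ x zero    = trans (*-identityˡ x) (sym (*-identityʳ x))
  pow-sucʳ x (suc m) = trans (*-assoc x (pow x m) x) (*-congˡ (pow-sucʳ x m))

  pow-† : ∀ x m → pow x m † ≈ pow (x †) m
  pow-† x zero    = 1#-selfAdjoint
  pow-† x (suc m) = begin
    (x * pow x m) †        ≈⟨ †-antidistrib x (pow x m) ⟩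
    pow x m † * x †        ≈⟨ *-congʳ (pow-† x m) ⟩
    pow (x †) m * x †      ≈⟨ pow-sucʳ (x †) m ⟩
    pow (x †) (suc m)      ∎

  pow-slide : ∀ a b m → a * pow (b * a) m ≈ pow (a * b) m * a
  pow-slide a b zero    = trans (*-identityʳ a) (sym (*-identityˡ a))
  pow-slide a b (suc m) = begin
    a * (b * a * pow (b * a) m)    ≈⟨ solve 3 (λ a b p → a ⊕ ((b ⊕ a) ⊕ p) ⊜ (a ⊕ b) ⊕ (a ⊕ p)) refl a b (pow (b * a) m) ⟩
    a * b * (a * pow (b * a) m)    ≈⟨ *-congˡ (pow-slide a b m) ⟩
    a * b * (pow (a * b) m * a)    ≈⟨ *-assoc (a * b) (pow (a * b) m) a ⟨
    pow (a * b) (suc m) * a        ∎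

  pow-sandwich : ∀ a b m → a * pow (b * a) m * b ≈ pow (a * b) (suc m)
  pow-sandwich a b m = begin
    a * pow (b * a) m * b    ≈⟨ *-congʳ (pow-slide a b m) ⟩
    pow (a * b) m * a * b    ≈⟨ *-assoc (pow (a * b) m) a b ⟩
    pow (a * b) m * (a * b)  ≈⟨ pow-sucʳ (a * b) m ⟩
    pow (a * b) (suc m)      ∎

module GroverIteration {c ℓ : Level} (R : StarRing c ℓ) (C Pψ PE : StarRing.Carrier R)
                       (Pψ-selfAdjoint : StarRingProperties.SelfAdjoint R Pψ)
                       (PE-selfAdjoint : StarRingProperties.SelfAdjoint R PE) where
  open StarRing R
  open StarOps R
  open StarRingProperties R
  open SetoidReasoning setoid
  open MonoidSolver *-monoid using (solve; _⊜_; _⊕_)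

  Sψ SP Ref Q : Carrier
  Sψ  = reflect Pψ
  SP  = reflect PE
  Ref = C * Sψ * C †
  Q   = QOp C Pψ PE

  SP-selfAdjoint : SelfAdjoint SP
  SP-selfAdjoint = reflect-selfAdjoint PE-selfAdjoint

  Ref-selfAdjoint : SelfAdjoint Ref
  Ref-selfAdjoint = conjugate-selfAdjoint C (reflect-selfAdjoint Pψ-selfAdjoint)

  pow-Q-† : ∀ m → pow Q m † ≈ pow (SP * Ref) m
  pow-Q-† m = trans (pow-† Q m) (pow-cong m (†-*-selfAdjoint Ref-selfAdjoint SP-selfAdjoint))

  grover-cong : ∀ {D D′} → D ≈ D′ → grover Pψ PE D ≈ grover Pψ PE D′
  grover-cong D≈D′ = *-cong (*-congʳ (*-cong (*-congʳ D≈D′) (†-cong D≈D′))) D≈D′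

  grover-pow : ∀ m → grover Pψ PE (pow Q m * C) ≈ pow Q (tripleSucc m) * C
  grover-pow m = begin
    D * Sψ * D † * SP * D                          ≈⟨ *-congʳ (*-congʳ (*-congˡ (†-antidistrib Qᵐ C))) ⟩
    D * Sψ * (C † * Qᵐ †) * SP * D                 ≈⟨ solve 6 (λ q c s c† q† sp →
                                                        ((((q ⊕ c) ⊕ s) ⊕ (c† ⊕ q†)) ⊕ sp) ⊕ (q ⊕ c)
                                                        ⊜ ((q ⊕ ((((c ⊕ s) ⊕ c†) ⊕ q†) ⊕ sp)) ⊕ q) ⊕ c)
                                                      refl Qᵐ C Sψ (C †) (Qᵐ †) SP ⟩
    Qᵐ * (Ref * Qᵐ † * SP) * Qᵐ * C                ≈⟨ *-congʳ (*-congʳ (*-congˡ (*-congʳ (*-congˡ (pow-Q-† m))))) ⟩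
    Qᵐ * (Ref * pow (SP * Ref) m * SP) * Qᵐ * C    ≈⟨ *-congʳ (*-congʳ (*-congˡ (pow-sandwich Ref SP m))) ⟩
    Qᵐ * pow Q (suc m) * Qᵐ * C                    ≈⟨ *-congʳ (*-congʳ (pow-+ Q m (suc m))) ⟨
    pow Q (m ℕ.+ suc m) * Qᵐ * C                   ≈⟨ *-congʳ (pow-+ Q (m ℕ.+ suc m) m) ⟨
    pow Q (tripleSucc m) * C                       ∎
    where
    Qᵐ D : Carrier
    Qᵐ = pow Q m
    D  = Qᵐ * C

  circ≈pow : ∀ j → circ C Pψ PE j ≈ pow Q (groverExponent j) * C
  circ≈pow zero    = sym (*-identityˡ C)
  circ≈pow (suc j) = trans (grover-cong (circ≈pow j)) (grover-pow (groverExponent j))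

lemma3 : ∀ {c ℓ : Level} (R : StarRing c ℓ) →
    let open StarRing R in
    let open StarOps R in
    (C Pψ PE : Carrier) → IsUnitary C → IsProjector Pψ → IsProjector PE →
    (k : ℕ) → (j : ℕ) → 1 ≤ j → j ≤ k →
    circ C Pψ PE j ≈ pow (QOp C Pψ PE) ((3 ^ j ∸ 1) / 2) * C
lemma3 R C Pψ PE _ (Pψ-selfAdjoint , _) (PE-selfAdjoint , _) _ j _ _ =
  ≡.subst (λ n → circ C Pψ PE j ≈ pow (QOp C Pψ PE) n * C)
          (groverExponent≡[3^j∸1]/2 j)
          (circ≈pow j)
  where
  open StarRing R
  open StarOps R
  open GroverIteration R C Pψ PE Pψ-selfAdjoint PE-selfAdjoint
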